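{- Let $n$ be a positive integer. Then $d_g(P_n)=1$, and $d_g'(P_n)=1$ if $n$ is odd and $d_g'(P_n)=2$ if $n$ is even.
   Context: $P_n$ denotes the path on $n$ vertices. For a vertex $x$, $N[x]$ denotes its closed neighborhood. The domatic number game on a graph $G$ with palette $[k]=\{1,\dots,k\}$: two players, Alice and Bob, alternately choose a previously unchosen vertex of $G$ and assign it a color from $[k]$, until every vertex has been colored. Let $V_i$ be the set of vertices colored $i$. Alice wins if every $V_i$ ($i\in[k]$) is a dominating set of $G$, i.e. for every vertex $x$ and every color $c\in[k]$ some vertex of $N[x]$ has color $c$; otherwise Bob wins. In the $A$-game Alice moves first; in the $B$-game Bob moves first. The game domatic number $d_g(G)$ is the largest $k$ for which Alice has a winning strategy in the $A$-game with palette $[k]$, and the delayed game domatic number $d_g'(G)$ is the largest $k$ for which Alice has a winning strategy in the $B$-game with palette $[k]$. -}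

module Defs where

open import Data.Nat using (ℕ; suc; _+_; _≤_)
open import Data.Fin using (Fin; toℕ; _≟_)
open import Data.Maybe using (Maybe; just; nothing)
open import Data.Product using (Σ; _×_; ∃; _,_)
open import Data.Sum using (_⊎_)
open import Relation.Nullary using (¬_; yes; no)
open import Relation.Binary.PropositionalEquality using (_≡_)

record Graph (n : ℕ) : Set₁ where
  field
    Adj : Fin n → Fin n → Set
open Graph public

Path : (n : ℕ) → Graph n
Path n = record { Adj = λ i j → (suc (toℕ i) ≡ toℕ j) ⊎ (suc (toℕ j) ≡ toℕ i) }

InClosedNbhd : ∀ {n} → Graph n → Fin n → Fin n → Set
InClosedNbhd G x y = (y ≡ x) ⊎ Adj G x y

PartialColouring : ℕ → ℕ → Set
PartialColouring n k = Fin n → Maybe (Fin k)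

update : ∀ {n k} → PartialColouring n k → Fin n → Fin k → PartialColouring n k
update c v a w with w ≟ v
... | yes _ = just a
... | no  _ = c w

Complete : ∀ {n k} → PartialColouring n k → Set
Complete {n} c = ∀ (v : Fin n) → ¬ (c v ≡ nothing)

AllClassesDominating : ∀ {n k} → Graph n → PartialColouring n k → Set
AllClassesDominating {n} {k} G c =
  ∀ (x : Fin n) (i : Fin k) → ∃ λ y → InClosedNbhd G x y × (c y ≡ just i)

data Player : Set where
  alice bob : Player

-- AliceWins G k p c : from the position c with player p to move,
-- Alice has a winning strategy (the game is finite, so this inductive
-- definition captures exactly the existence of a winning strategy).
data AliceWins {n : ℕ} (G : Graph n) (k : ℕ) : Player → PartialColouring n k → Set where
  finished : ∀ {p c} → Complete c → AllClassesDominating G c → AliceWins G k p c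
  aliceMove : ∀ {c} (v : Fin n) (a : Fin k) → c v ≡ nothing →
              AliceWins G k bob (update c v a) → AliceWins G k alice c
  bobMove : ∀ {c} → ¬ Complete c →
            (∀ (v : Fin n) (a : Fin k) → c v ≡ nothing → AliceWins G k alice (update c v a)) →
            AliceWins G k bob c

empty : ∀ {n k} → PartialColouring n k
empty _ = nothing

AliceWinsAGame AliceWinsBGame : ∀ {n} → Graph n → ℕ → Set
AliceWinsAGame G k = AliceWins G k alice empty
AliceWinsBGame G k = AliceWins G k bob empty

GameDomaticNumberIs : ∀ {n} → Graph n → ℕ → Set
GameDomaticNumberIs G d = AliceWinsAGame G d × (∀ k → suc d ≤ k → ¬ AliceWinsAGame G k)

DelayedGameDomaticNumberIs : ∀ {n} → Graph n → ℕ → Set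
DelayedGameDomaticNumberIs G d = AliceWinsBGame G d × (∀ k → suc d ≤ k → ¬ AliceWinsBGame G k)

module Submission where

-- With one colour every complete colouring is dominating. With three or more, the closed
-- neighbourhood {0, 1} of an end vertex cannot meet every colour class (pigeonhole).
-- With two colours a vertex whose closed neighbourhood is monochromatic is not dominated
-- by the other colour, so Bob wins as soon as he can complete such a neighbourhood.
-- In the A-game Bob gives a neighbour of Alice's first vertex the same colour, which
-- threatens both ends of the monochromatic edge at once. In the B-game on an odd path Bob
-- colours vertex 1; whenever Alice blocks the vertex left of his last move he colours the
-- vertex two further right, and when he finally colours the last vertex its closed
-- neighbourhood is monochromatic.
-- On an even path Alice answers every move with the other colour on the partner vertex in
-- the perfect matching {0,1}, {2,3}, …, so every vertex sees both colours.

open import Defs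
open import Data.Nat using (ℕ; zero; suc; _+_; _*_; _≤_; _<_; z≤n; s≤s; z<s; _<?_)
  renaming (_≟_ to _≟ℕ_)
open import Data.Nat.Properties
  using ( ≤-trans; ≤-reflexive; ≤⇒≯; ≮⇒≥; n≤1+n; n<1+n; <-trans; m<m+n; *-comm; +-comm
        ; suc-injective; 1+n≢n; 1+n≰n; m≢1+n+m; m≤n⇒m<n∨m≡n)
open import Data.Nat.Tactic.RingSolver using (solve-∀)
open import Data.Fin using (Fin; zero; suc; toℕ; fromℕ<; _≟_)
import Data.Fin as Fin
open import Data.Fin.Properties using (toℕ-injective; toℕ<n; toℕ-fromℕ<; any?; pigeonhole)
  renaming (<⇒≢ to <⇒≢ᶠ; suc-injective to suc-injectiveᶠ)
open import Data.Fin.Subset using (Subset; _∈_; _⊂_)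
open import Data.Fin.Subset.Properties using (⊂-trans)
open import Data.Fin.Subset.Induction using (Acc; acc; ⊂-wellFounded)
open import Data.Vec using (tabulate)
open import Data.Vec.Properties using (lookup∘tabulate; []=⇒lookup; lookup⇒[]=)
open import Data.Maybe using (Maybe; just; nothing; is-nothing)
import Data.Maybe as Maybe
open import Data.Maybe.Properties using (just-injective; ≡-dec)
open import Data.Bool using (true)
open import Data.Product using (_×_; _,_; proj₁; ∃; ∃₂)
open import Data.Sum using (_⊎_; inj₁; inj₂)
import Data.Sum as Sum
open import Data.Unit using (⊤; tt)
open import Data.Empty using (⊥-elim)
open import Function using (_∘_)
open import Relation.Nullary using (¬_; Dec; yes; no)
open import Relation.Binary.PropositionalEquality
  using (_≡_; _≢_; refl; sym; trans; cong; subst; module ≡-Reasoning)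

private
  variable
    n k : ℕ
    p : Player

update-≡ : ∀ (c : PartialColouring n k) v a → update c v a v ≡ just a
update-≡ c v a with v ≟ v
... | yes _  = refl
... | no v≢v = ⊥-elim (v≢v refl)

update-≢ : ∀ (c : PartialColouring n k) {v w} a → w ≢ v → update c v a w ≡ c w
update-≢ c {v} {w} a w≢v with w ≟ v
... | yes w≡v = ⊥-elim (w≢v w≡v)
... | no _    = refl

update-nothing : ∀ (c : PartialColouring n k) {v w a} → update c v a w ≡ nothing → c w ≡ nothing
update-nothing c {v} {w} e with w ≟ v
... | no _ = e

update-preserves-just : ∀ (c : PartialColouring n k) {v w} a {b} →
                        c v ≡ nothing → c w ≡ just b → update c v a w ≡ just b
update-preserves-just c {v} {w} a cv≡nothing cw≡just with w ≟ v
... | no _ = cw≡just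
... | yes refl with trans (sym cv≡nothing) cw≡just
...   | ()

update-at : ∀ (c : PartialColouring n k) {v w} a → toℕ w ≡ toℕ v → update c v a w ≡ just a
update-at c {v} a e with toℕ-injective e
... | refl = update-≡ c v a

complete⊎free : (c : PartialColouring n k) → Complete c ⊎ ∃ λ v → c v ≡ nothing
complete⊎free c with any? (λ v → ≡-dec _≟_ (c v) nothing)
... | yes free = inj₂ free
... | no ¬free = inj₁ λ v cv≡nothing → ¬free (v , cv≡nothing)

bob-plays : ∀ {G : Graph n} {c : PartialColouring n k} v a → c v ≡ nothing →
            ¬ AliceWins G k alice (update c v a) → ¬ AliceWins G k bob c
bob-plays v a cv≡nothing lost (finished complete _) = complete v cv≡nothing
bob-plays v a cv≡nothing lost (bobMove _ reply)     = lost (reply v a cv≡nothing)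

module _ {G : Graph n} (Bad : PartialColouring n k → Set)
         (bad⇒¬dominating : ∀ {c} → Bad c → ¬ AllClassesDominating G c)
         (bad-update : ∀ {c v a} → c v ≡ nothing → Bad c → Bad (update c v a))
         (a : Fin k) where

  loses-by-invariant : ∀ {c} → Bad c → ¬ AliceWins G k p c
  loses-by-invariant bad (finished _ dominating) = bad⇒¬dominating bad dominating
  loses-by-invariant bad (aliceMove v b cv≡nothing win) = loses-by-invariant (bad-update cv≡nothing bad) win
  loses-by-invariant {c = c} bad (bobMove ¬complete reply) with complete⊎free c
  ... | inj₁ complete          = ¬complete complete
  ... | inj₂ (v , cv≡nothing) = loses-by-invariant (bad-update cv≡nothing bad) (reply v a cv≡nothing)

freeSet : PartialColouring n k → Subset n
freeSet c = tabulate (is-nothing ∘ c)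

∈-freeSet⁺ : ∀ {c : PartialColouring n k} {v} → c v ≡ nothing → v ∈ freeSet c
∈-freeSet⁺ {c = c} {v} cv≡nothing =
  lookup⇒[]= v (freeSet c) (trans (lookup∘tabulate (is-nothing ∘ c) v) (cong is-nothing cv≡nothing))

∈-freeSet⁻ : ∀ {c : PartialColouring n k} {v} → v ∈ freeSet c → c v ≡ nothing
∈-freeSet⁻ {c = c} {v} v∈ =
  is-nothing⇒nothing (trans (sym (lookup∘tabulate (is-nothing ∘ c) v)) ([]=⇒lookup v∈))
  where
  is-nothing⇒nothing : ∀ {A : Set} {m : Maybe A} → is-nothing m ≡ true → m ≡ nothing
  is-nothing⇒nothing {m = nothing} _ = refl

freeSet-update-⊂ : ∀ {c : PartialColouring n k} {v a} → c v ≡ nothing →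
                   freeSet (update c v a) ⊂ freeSet c
freeSet-update-⊂ {c = c} {v} {a} cv≡nothing =
    (λ w∈ → ∈-freeSet⁺ (update-nothing c (∈-freeSet⁻ w∈)))
  , v , ∈-freeSet⁺ cv≡nothing
  , λ v∈ → just≢nothing (trans (sym (update-≡ c v a)) (∈-freeSet⁻ v∈))
  where
  just≢nothing : ∀ {A : Set} {b : A} → just b ≢ nothing
  just≢nothing ()

Restorable : (PartialColouring n k → Set) → PartialColouring n k → Set
Restorable Inv c = (Complete c × Inv c) ⊎ ∃₂ λ w b → c w ≡ nothing × Inv (update c w b)

module _ {G : Graph n} (Inv : PartialColouring n k → Set)
         (inv⇒dominating : ∀ {c} → Complete c → Inv c → AllClassesDominating G c)
         (reply : ∀ {c v a} → Inv c → c v ≡ nothing → Restorable Inv (update c v a)) where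

  wins-by-reply : ∀ {c} → Inv c → AliceWins G k bob c
  wins-by-reply inv = go inv (⊂-wellFounded _)
    where
    go : ∀ {c} → Inv c → Acc _⊂_ (freeSet c) → AliceWins G k bob c
    go {c} inv (acc smaller) with complete⊎free c
    ... | inj₁ complete          = finished complete (inv⇒dominating complete inv)
    ... | inj₂ (u , cu≡nothing) = bobMove (λ complete → complete u cu≡nothing) respond
      where
      respond : ∀ v a → c v ≡ nothing → AliceWins G k alice (update c v a)
      respond v a cv≡nothing with reply inv cv≡nothing
      ... | inj₁ (complete , inv′) = finished complete (inv⇒dominating complete inv′)
      ... | inj₂ (w , b , cw≡nothing , inv′) =
        aliceMove w b cw≡nothing
          (go inv′ (smaller (⊂-trans (freeSet-update-⊂ cw≡nothing) (freeSet-update-⊂ cv≡nothing))))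

palette-1-dominating : ∀ {G : Graph n} {c : PartialColouring n 1} → Complete c → AllClassesDominating G c
palette-1-dominating {c = c} complete x zero with c x in cx
... | just zero = x , inj₁ refl , cx
... | nothing   = ⊥-elim (complete x cx)

palette-1-wins : ∀ {G : Graph n} p (c : PartialColouring n 1) → AliceWins G 1 p c
palette-1-wins {n} bob c = wins-by-reply (λ _ → ⊤) (λ complete _ → palette-1-dominating complete) reply tt
  where
  reply : ∀ {c : PartialColouring n 1} {v a} → ⊤ → c v ≡ nothing →
          Restorable (λ _ → ⊤) (update c v a)
  reply {c} {v} {a} _ _ with complete⊎free (update c v a)
  ... | inj₁ complete          = inj₁ (complete , tt)
  ... | inj₂ (w , cw≡nothing) = inj₂ (w , zero , cw≡nothing , tt)
palette-1-wins alice c with complete⊎free c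
... | inj₁ complete          = finished complete (palette-1-dominating complete)
... | inj₂ (v , cv≡nothing) = aliceMove v zero cv≡nothing (palette-1-wins bob _)

Coloured : (Fin n → Set) → PartialColouring n k → Fin k → Set
Coloured P c a = ∀ y → P y → c y ≡ just a

Free : (Fin n → Set) → PartialColouring n k → Set
Free P c = ∀ y → P y → c y ≡ nothing

coloured-update : ∀ {P : Fin n → Set} {c : PartialColouring n k} {v a b} →
                  c v ≡ nothing → Coloured P c a → Coloured P (update c v b) a
coloured-update {c = c} {b = b} cv≡nothing coloured y Py =
  update-preserves-just c b cv≡nothing (coloured y Py)

free-update : ∀ {P : Fin n → Set} {c : PartialColouring n k} {v b} →
              ¬ P v → Free P c → Free P (update c v b)
free-update {c = c} ¬Pv free y Py = trans (update-≢ c _ λ { refl → ¬Pv Py }) (free y Py)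

monochromatic⇒loses : ∀ {G : Graph n} {c : PartialColouring n k} {x} {a i : Fin k} → i ≢ a →
                      Coloured (InClosedNbhd G x) c a → ¬ AliceWins G k p c
monochromatic⇒loses {G = G} {x = x} {a} {i} i≢a =
  loses-by-invariant (λ c → Coloured (InClosedNbhd G x) c a) ¬dominating coloured-update a
  where
  ¬dominating : ∀ {c} → Coloured (InClosedNbhd G x) c a → ¬ AllClassesDominating G c
  ¬dominating mono dominating with dominating x i
  ... | y , y∈N[x] , cy≡i = i≢a (just-injective (trans (sym cy≡i) (mono y y∈N[x])))

dominating⇒palette≤ : ∀ {m} {G : Graph n} {c : PartialColouring n k} (x : Fin n) (ι : Fin n → Fin m) →
  (∀ {y z} → InClosedNbhd G x y → InClosedNbhd G x z → ι y ≡ ι z → y ≡ z) →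
  AllClassesDominating G c → k ≤ m
dominating⇒palette≤ {c = c} x ι ι-injective dominating = ≮⇒≥ λ m<k →
  let i , j , i<j , ιyᵢ≡ιyⱼ = pigeonhole m<k (λ i → ι (proj₁ (dominating x i)))
      yᵢ , yᵢ∈N[x] , cyᵢ≡i = dominating x i
      yⱼ , yⱼ∈N[x] , cyⱼ≡j = dominating x j
  in <⇒≢ᶠ i<j (just-injective (begin
       just i  ≡⟨ sym cyᵢ≡i ⟩
       c yᵢ    ≡⟨ cong c (ι-injective yᵢ∈N[x] yⱼ∈N[x] ιyᵢ≡ιyⱼ) ⟩
       c yⱼ    ≡⟨ cyⱼ≡j ⟩
       just j  ∎))
  where open ≡-Reasoning

other : Fin 2 → Fin 2
other zero       = suc zero
other (suc zero) = zero

other-≢ : ∀ a → other a ≢ a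
other-≢ zero       ()
other-≢ (suc zero) ()

other-involutive : ∀ a → other (other a) ≡ a
other-involutive zero       = refl
other-involutive (suc zero) = refl

≢⇒other≡ : ∀ {a i} → a ≢ i → other a ≡ i
≢⇒other≡ {zero}     {zero}     a≢i = ⊥-elim (a≢i refl)
≢⇒other≡ {zero}     {suc zero} _   = refl
≢⇒other≡ {suc zero} {zero}     _   = refl
≢⇒other≡ {suc zero} {suc zero} a≢i = ⊥-elim (a≢i refl)

module PerfectMatching {G : Graph n} (partner : Fin n → Fin n)
         (partner-involutive : ∀ v → partner (partner v) ≡ v)
         (partner-≢ : ∀ v → partner v ≢ v)
         (partner-adjacent : ∀ v → Adj G v (partner v)) where

  Paired : PartialColouring n 2 → Set
  Paired c = ∀ v → c (partner v) ≡ Maybe.map other (c v)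

  paired-dominating : ∀ {c} → Complete c → Paired c → AllClassesDominating G c
  paired-dominating {c} complete paired x i with c x in cx
  ... | nothing = ⊥-elim (complete x cx)
  ... | just a with a ≟ i
  ...   | yes refl = x , inj₁ refl , cx
  ...   | no a≢i   = partner x , inj₂ (partner-adjacent x) ,
                     trans (paired x) (trans (cong (Maybe.map other) cx) (cong just (≢⇒other≡ a≢i)))

  partner-injective : ∀ {v w} → partner v ≡ partner w → v ≡ w
  partner-injective {v} {w} pv≡pw = begin
    v                   ≡⟨ sym (partner-involutive v) ⟩
    partner (partner v) ≡⟨ cong partner pv≡pw ⟩
    partner (partner w) ≡⟨ partner-involutive w ⟩
    w                   ∎
    where open ≡-Reasoning

  colour-pair : PartialColouring n 2 → Fin n → Fin 2 → PartialColouring n 2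
  colour-pair c v a = update (update c v a) (partner v) (other a)

  colour-pair-partner : ∀ c v a → colour-pair c v a (partner v) ≡ just (other a)
  colour-pair-partner c v a = update-≡ (update c v a) (partner v) (other a)

  colour-pair-self : ∀ c v a → colour-pair c v a v ≡ just a
  colour-pair-self c v a = trans (update-≢ (update c v a) (other a) (partner-≢ v ∘ sym)) (update-≡ c v a)

  colour-pair-elsewhere : ∀ c {v w} a → w ≢ v → w ≢ partner v → colour-pair c v a w ≡ c w
  colour-pair-elsewhere c {v} a w≢v w≢pv =
    trans (update-≢ (update c v a) (other a) w≢pv) (update-≢ c a w≢v)

  paired-colour-pair : ∀ {c} v a → Paired c → Paired (colour-pair c v a)
  paired-colour-pair {c} v a paired w = by-cases (w ≟ v) (w ≟ partner v)
    where
    open ≡-Reasoning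
    c′ : PartialColouring n 2
    c′ = colour-pair c v a
    by-cases : Dec (w ≡ v) → Dec (w ≡ partner v) → c′ (partner w) ≡ Maybe.map other (c′ w)
    by-cases (yes w≡v) _ = begin
      c′ (partner w)                    ≡⟨ cong (c′ ∘ partner) w≡v ⟩
      c′ (partner v)                    ≡⟨ colour-pair-partner c v a ⟩
      just (other a)                    ≡⟨ cong (Maybe.map other) (sym (colour-pair-self c v a)) ⟩
      Maybe.map other (c′ v)            ≡⟨ cong (Maybe.map other ∘ c′) (sym w≡v) ⟩
      Maybe.map other (c′ w)            ∎
    by-cases (no _) (yes w≡pv) = begin
      c′ (partner w)                    ≡⟨ cong (c′ ∘ partner) w≡pv ⟩
      c′ (partner (partner v))          ≡⟨ cong c′ (partner-involutive v) ⟩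
      c′ v                              ≡⟨ colour-pair-self c v a ⟩
      just a                            ≡⟨ cong just (sym (other-involutive a)) ⟩
      just (other (other a))            ≡⟨ cong (Maybe.map other) (sym (colour-pair-partner c v a)) ⟩
      Maybe.map other (c′ (partner v))  ≡⟨ cong (Maybe.map other ∘ c′) (sym w≡pv) ⟩
      Maybe.map other (c′ w)            ∎
    by-cases (no w≢v) (no w≢pv) = begin
      c′ (partner w)                    ≡⟨ colour-pair-elsewhere c a (w≢pv ∘ partner⇒≡partner) (w≢v ∘ partner-injective) ⟩
      c (partner w)                     ≡⟨ paired w ⟩
      Maybe.map other (c w)             ≡⟨ cong (Maybe.map other) (sym (colour-pair-elsewhere c a w≢v w≢pv)) ⟩
      Maybe.map other (c′ w)            ∎
      where
      partner⇒≡partner : partner w ≡ v → w ≡ partner v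
      partner⇒≡partner pw≡v = trans (sym (partner-involutive w)) (cong partner pw≡v)

  partner-free : ∀ {c v} a → Paired c → c v ≡ nothing → update c v a (partner v) ≡ nothing
  partner-free {c} {v} a paired cv≡nothing =
    trans (update-≢ c a (partner-≢ v)) (trans (paired v) (cong (Maybe.map other) cv≡nothing))

  perfect-matching-wins : AliceWinsBGame G 2
  perfect-matching-wins = wins-by-reply Paired paired-dominating reply (λ _ → refl)
    where
    reply : ∀ {c v a} → Paired c → c v ≡ nothing → Restorable Paired (update c v a)
    reply {v = v} {a} paired cv≡nothing =
      inj₂ (partner v , other a , partner-free a paired cv≡nothing , paired-colour-pair v a paired)

Near : ℕ → ℕ → Set
Near s t = suc t ≡ s ⊎ t ≡ s ⊎ t ≡ suc s

nbhd⇒near : ∀ {x y : Fin n} → InClosedNbhd (Path n) x y → Near (toℕ x) (toℕ y)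
nbhd⇒near (inj₁ refl)        = inj₂ (inj₁ refl)
nbhd⇒near (inj₂ (inj₁ x→y)) = inj₂ (inj₂ (sym x→y))
nbhd⇒near (inj₂ (inj₂ y→x)) = inj₁ y→x

suc∈N[zero]⇒toℕ≡0 : ∀ {w : Fin n} → InClosedNbhd (Path (suc n)) zero (suc w) → toℕ w ≡ 0
suc∈N[zero]⇒toℕ≡0 w∈ with nbhd⇒near w∈
... | inj₂ (inj₂ 1+w≡1) = suc-injective 1+w≡1

end-side : Fin (suc n) → Fin 2
end-side zero    = zero
end-side (suc _) = suc zero

end-side-injective : ∀ {y z : Fin (suc n)} → InClosedNbhd (Path (suc n)) zero y →
                     InClosedNbhd (Path (suc n)) zero z → end-side y ≡ end-side z → y ≡ z
end-side-injective {y = zero}  {zero}  _  _  _ = refl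
end-side-injective {y = suc _} {suc _} y∈ z∈ _ =
  cong suc (toℕ-injective (trans (suc∈N[zero]⇒toℕ≡0 y∈) (sym (suc∈N[zero]⇒toℕ≡0 z∈))))

path-palette>2-loses : ∀ {c : PartialColouring n k} → 1 ≤ n → 2 < k → ¬ AliceWins (Path n) k p c
path-palette>2-loses (s≤s z≤n) 2<k@(s≤s (s≤s (s≤s _))) =
  loses-by-invariant (λ _ → ⊤)
    (λ _ dominating → ≤⇒≯ (dominating⇒palette≤ zero end-side end-side-injective dominating) 2<k)
    (λ _ _ → tt) zero tt

path-partner : ∀ m → Fin (m * 2) → Fin (m * 2)
path-partner (suc m) zero          = suc zero
path-partner (suc m) (suc zero)    = zero
path-partner (suc m) (suc (suc v)) = suc (suc (path-partner m v))

path-partner-involutive : ∀ m (v : Fin (m * 2)) → path-partner m (path-partner m v) ≡ v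
path-partner-involutive (suc m) zero          = refl
path-partner-involutive (suc m) (suc zero)    = refl
path-partner-involutive (suc m) (suc (suc v)) = cong (Fin.suc ∘ Fin.suc) (path-partner-involutive m v)

path-partner-≢ : ∀ m (v : Fin (m * 2)) → path-partner m v ≢ v
path-partner-≢ (suc m) zero          ()
path-partner-≢ (suc m) (suc zero)    ()
path-partner-≢ (suc m) (suc (suc v)) pv≡v = path-partner-≢ m v (suc-injectiveᶠ (suc-injectiveᶠ pv≡v))

path-partner-adjacent : ∀ m (v : Fin (m * 2)) → Adj (Path (m * 2)) v (path-partner m v)
path-partner-adjacent (suc m) zero          = inj₁ refl
path-partner-adjacent (suc m) (suc zero)    = inj₂ refl
path-partner-adjacent (suc m) (suc (suc v)) =
  Sum.map (cong (2 +_)) (cong (2 +_)) (path-partner-adjacent m v)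

even-path-b-game-wins : ∀ m → AliceWinsBGame (Path (m * 2)) 2
even-path-b-game-wins m = PerfectMatching.perfect-matching-wins (path-partner m)
  (path-partner-involutive m) (path-partner-≢ m) (path-partner-adjacent m)

-- When no vertex has index t, At t is empty; this lets a window at an end of the path
-- have its hole outside the path.
At : ℕ → Fin n → Set
At t y = toℕ y ≡ t

Window : ℕ → ℕ → Fin n → Set
Window s t y = Near s (toℕ y) × toℕ y ≢ t

no-vertex-at : ∀ {t} {y : Fin n} → n ≤ t → ¬ At t y
no-vertex-at {y = y} n≤t y≡t = ≤⇒≯ n≤t (subst (_< _) y≡t (toℕ<n y))

play-at : ∀ (c : PartialColouring n k) {t} (t<n : t < n) a → Coloured (At t) (update c (fromℕ< t<n) a) a
play-at c t<n a y y≡t = update-at c a (trans y≡t (sym (toℕ-fromℕ< t<n)))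

window-fill : ∀ {c : PartialColouring n k} {s t a} (x : Fin n) → toℕ x ≡ s →
              Coloured (Window s t) c a → Coloured (At t) c a → Coloured (InClosedNbhd (Path n) x) c a
window-fill {t = t} x refl window hole y y∈N[x] with toℕ y ≟ℕ t
... | yes y∈hole = hole y y∈hole
... | no  y∉hole = window y (nbhd⇒near y∈N[x] , y∉hole)

window-loses : ∀ {c : PartialColouring n 2} {s t a} → s < n →
               Coloured (Window s t) c a → Free (At t) c → ¬ AliceWins (Path n) 2 bob c
window-loses {n} {c = c} {s} {t} {a} s<n window hole with t <? n
... | yes t<n = bob-plays w a cw≡nothing (monochromatic⇒loses (other-≢ a)
      (window-fill (fromℕ< s<n) (toℕ-fromℕ< s<n) (coloured-update cw≡nothing window) (play-at c t<n a)))
  where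
  w : Fin n
  w = fromℕ< t<n
  cw≡nothing : c w ≡ nothing
  cw≡nothing = hole w (toℕ-fromℕ< t<n)
... | no t≮n = monochromatic⇒loses (other-≢ a)
      (window-fill (fromℕ< s<n) (toℕ-fromℕ< s<n) window
        λ y y≡t → ⊥-elim (no-vertex-at (≮⇒≥ t≮n) y≡t))

must-block : ∀ {c : PartialColouring n 2} {s t a} → s < n →
             Coloured (Window s t) c a → Free (At t) c →
             (∀ v b → c v ≡ nothing → At t v → ¬ AliceWins (Path n) 2 bob (update c v b)) →
             ¬ AliceWins (Path n) 2 alice c
must-block s<n window hole blocked (finished complete dominating) =
  window-loses s<n window hole (finished complete dominating)
must-block {t = t} s<n window hole blocked (aliceMove v b cv≡nothing win) with toℕ v ≟ℕ t
... | yes v∈hole = blocked v b cv≡nothing v∈hole win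
... | no  v∉hole = window-loses s<n (coloured-update cv≡nothing window) (free-update v∉hole hole) win

-- A double threat: Alice can block only one of the two holes.
monochromatic-edge-loses : ∀ {c : PartialColouring n 2} {s a} → suc (suc s) < n →
  Coloured (At (suc s)) c a → Coloured (At (suc (suc s))) c a →
  Free (At s) c → Free (At (suc (suc (suc s)))) c → ¬ AliceWins (Path n) 2 alice c
monochromatic-edge-loses {n} {c = c} {s} {a} 2+s<n left right hole-left hole-right =
  must-block (<-trans (n<1+n (suc s)) 2+s<n) window-left hole-left blocked
  where
  window-left : Coloured (Window (suc s) s) c a
  window-left y (inj₁ 1+y≡1+s , y≢s)    = ⊥-elim (y≢s (suc-injective 1+y≡1+s))
  window-left y (inj₂ (inj₁ y≡1+s) , _) = left y y≡1+s
  window-left y (inj₂ (inj₂ y≡2+s) , _) = right y y≡2+s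
  blocked : ∀ z b → c z ≡ nothing → At s z → ¬ AliceWins (Path n) 2 bob (update c z b)
  blocked z b cz≡nothing z≡s =
    window-loses 2+s<n window-right
      (free-update (λ z≡3+s → m≢1+n+m s {2} (trans (sym z≡s) z≡3+s)) hole-right)
    where
    window-right : Coloured (Window (suc (suc s)) (suc (suc (suc s)))) (update c z b) a
    window-right y (inj₁ 1+y≡2+s , _)         = coloured-update cz≡nothing left y (suc-injective 1+y≡2+s)
    window-right y (inj₂ (inj₁ y≡2+s) , _)     = coloured-update cz≡nothing right y y≡2+s
    window-right y (inj₂ (inj₂ y≡3+s) , y≢3+s) = ⊥-elim (y≢3+s y≡3+s)

first-move-loses : ∀ (v : Fin n) a → ¬ AliceWins (Path n) 2 bob (update empty v a)
first-move-loses {suc n} zero a =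
  window-loses {s = 0} {t = 1} z<s window (free-update (λ ()) λ _ _ → refl)
  where
  window : Coloured (Window 0 1) (update {suc n} empty zero a) a
  window y (inj₂ (inj₁ y≡0) , _)   = update-at empty a y≡0
  window y (inj₂ (inj₂ y≡1) , y≢1) = ⊥-elim (y≢1 y≡1)
first-move-loses {suc (suc n)} (suc zero) a =
  window-loses {s = 0} {t = 0} z<s window (free-update (λ ()) λ _ _ → refl)
  where
  window : Coloured (Window 0 0) (update {suc (suc n)} empty (suc zero) a) a
  window y (inj₂ (inj₁ y≡0) , y≢0) = ⊥-elim (y≢0 y≡0)
  window y (inj₂ (inj₂ y≡1) , _)   = update-at empty a y≡1
first-move-loses {suc (suc n)} (suc (suc w)) a =
  bob-plays u a cu≡nothing (monochromatic-edge-loses (toℕ<n v) u-coloured v-coloured hole-left hole-right)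
  where
  t : ℕ
  t = toℕ w
  v : Fin (suc (suc n))
  v = suc (suc w)
  1+t<n : suc t < suc (suc n)
  1+t<n = <-trans (n<1+n (suc t)) (toℕ<n v)
  u : Fin (suc (suc n))
  u = fromℕ< 1+t<n
  u-index : toℕ u ≡ suc t
  u-index = toℕ-fromℕ< 1+t<n
  c₁ c₂ : PartialColouring (suc (suc n)) 2
  c₁ = update empty v a
  c₂ = update c₁ u a
  cu≡nothing : c₁ u ≡ nothing
  cu≡nothing = free-update {P = At (suc t)} {v = v} 1+n≢n (λ _ _ → refl) u u-index
  u-coloured : Coloured (At (suc t)) c₂ a
  u-coloured = play-at c₁ 1+t<n a
  v-coloured : Coloured (At (suc (suc t))) c₂ a
  v-coloured = coloured-update cu≡nothing λ y y≡2+t → update-at empty a y≡2+t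
  hole-left : Free (At t) c₂
  hole-left = free-update (λ u≡t → 1+n≢n (trans (sym u-index) u≡t))
                (free-update (m≢1+n+m t {1} ∘ sym) λ _ _ → refl)
  hole-right : Free (At (suc (suc (suc t)))) c₂
  hole-right = free-update (λ u≡3+t → m≢1+n+m (suc t) {1} (trans (sym u-index) u≡3+t))
                 (free-update (1+n≢n ∘ sym) λ _ _ → refl)

path-a-game-loses : 1 ≤ n → ¬ AliceWinsAGame (Path n) 2
path-a-game-loses (s≤s z≤n) (finished complete _)  = complete zero refl
path-a-game-loses _         (aliceMove v a _ win) = first-move-loses v a win

Left : ℕ → Fin n → Set
Left s y = suc (toℕ y) ≡ s

From : ℕ → Fin n → Set
From s y = s ≤ toℕ y

odd-step : ∀ s r → s + suc (2 * suc r) ≡ suc (suc s) + suc (2 * r)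
odd-step = solve-∀

-- Bob colours s + 1, forcing Alice to answer at s, which re-establishes the invariant at
-- s + 2; when only vertex s is left, Bob colours it and N[s] becomes monochromatic.
odd-path-loses-from : ∀ r {s} {c : PartialColouring n 2} {a} → n ≡ s + suc (2 * r) →
                      Coloured (Left s) c a → Free (From s) c → ¬ AliceWins (Path n) 2 bob c
odd-path-loses-from zero {s} {c} {a} refl left rest =
  window-loses (m<m+n s z<s) window λ y y≡s → rest y (≤-reflexive (sym y≡s))
  where
  window : Coloured (Window s s) c a
  window y (inj₁ 1+y≡s , _)           = left y 1+y≡s
  window y (inj₂ (inj₁ y≡s) , y≢s)   = ⊥-elim (y≢s y≡s)
  window y (inj₂ (inj₂ y≡1+s) , _)   = ⊥-elim (no-vertex-at (≤-reflexive (+-comm s 1)) y≡1+s)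
odd-path-loses-from {n} (suc r) {s} {c} {a} n≡ left rest =
  bob-plays u a cu≡nothing (must-block s<n window hole blocked)
  where
  n≡′ : n ≡ suc (suc s) + suc (2 * r)
  n≡′ = trans n≡ (odd-step s r)
  1+s<n : suc s < n
  1+s<n = <-trans (n<1+n (suc s)) (subst (suc (suc s) <_) (sym n≡′) (m<m+n (suc (suc s)) z<s))
  s<n : s < n
  s<n = <-trans (n<1+n s) 1+s<n
  u : Fin n
  u = fromℕ< 1+s<n
  u-index : toℕ u ≡ suc s
  u-index = toℕ-fromℕ< 1+s<n
  c₁ : PartialColouring n 2
  c₁ = update c u a
  cu≡nothing : c u ≡ nothing
  cu≡nothing = rest u (≤-trans (n≤1+n s) (≤-reflexive (sym u-index)))
  window : Coloured (Window s s) c₁ a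
  window y (inj₁ 1+y≡s , _)           = coloured-update cu≡nothing left y 1+y≡s
  window y (inj₂ (inj₁ y≡s) , y≢s)   = ⊥-elim (y≢s y≡s)
  window y (inj₂ (inj₂ y≡1+s) , _)   = play-at c 1+s<n a y y≡1+s
  hole : Free (At s) c₁
  hole = free-update (λ u≡s → 1+n≢n (trans (sym u-index) u≡s))
           λ y y≡s → rest y (≤-reflexive (sym y≡s))
  blocked : ∀ v b → c₁ v ≡ nothing → At s v → ¬ AliceWins (Path n) 2 bob (update c₁ v b)
  blocked v b cv≡nothing v≡s = odd-path-loses-from r n≡′ left′ rest′
    where
    left′ : Coloured (Left (suc (suc s))) (update c₁ v b) a
    left′ y 2+y≡2+s = coloured-update cv≡nothing (play-at c 1+s<n a) y (suc-injective 2+y≡2+s)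
    rest′ : Free (From (suc (suc s))) (update c₁ v b)
    rest′ = free-update (λ 2+s≤v → 1+n≰n (≤-trans (n≤1+n (suc s)) (subst (suc (suc s) ≤_) v≡s 2+s≤v)))
              (free-update (λ 2+s≤u → 1+n≰n (subst (suc (suc s) ≤_) u-index 2+s≤u))
                λ y 2+s≤y → rest y (≤-trans (n≤1+n s) (≤-trans (n≤1+n (suc s)) 2+s≤y)))

odd-path-b-game-loses : ∀ m → ¬ AliceWinsBGame (Path (suc (2 * m))) 2
odd-path-b-game-loses m = odd-path-loses-from m {s = 0} {a = zero} refl (λ _ ()) (λ _ _ → refl)

path-palette≥2-loses : 1 ≤ n → ¬ AliceWins (Path n) 2 p empty →
                       ∀ k → 2 ≤ k → ¬ AliceWins (Path n) k p empty
path-palette≥2-loses 1≤n lost k 2≤k with m≤n⇒m<n∨m≡n 2≤k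
... | inj₁ 2<k  = path-palette>2-loses 1≤n 2<k
... | inj₂ refl = lost

corollary5p3 : (n : ℕ) → 1 ≤ n →
    GameDomaticNumberIs (Path n) 1
    × (∀ m → n ≡ suc (2 * m) → DelayedGameDomaticNumberIs (Path n) 1)
    × (∀ m → n ≡ 2 * m → DelayedGameDomaticNumberIs (Path n) 2)
corollary5p3 n 1≤n =
    (palette-1-wins alice empty , path-palette≥2-loses 1≤n (path-a-game-loses 1≤n))
  , (λ m n≡1+2m →
        palette-1-wins bob empty
      , path-palette≥2-loses 1≤n
          (subst (λ n → ¬ AliceWinsBGame (Path n) 2) (sym n≡1+2m) (odd-path-b-game-loses m)))
  , (λ m n≡2m →
        subst (λ n → AliceWinsBGame (Path n) 2) (trans (*-comm m 2) (sym n≡2m)) (even-path-b-game-wins m)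
      , λ k → path-palette>2-loses 1≤n)
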